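{- For all non-negative integers $m$ and $p$, \[ \sum_{n=0}^{p}\frac{c_{n}}{n!}\binom{p}{n}=\frac{(-1)^{p}}{p!}\,\hat c_{p}(-1),\qquad\text{where }\ \hat c_p(-1)=\sum_{k=0}^{p}s(p+1,k+1)\frac{(-1)^k}{k+1}, \] and \[ \sum_{n=m}^{p}\frac{s(n,m)}{n!}\binom{p}{n}=\frac{(-1)^{m}}{m!}\,Y_{m}\!\left(-0!\,H_{p},\,-1!\,H_p^{(2)},\,\ldots,\,-(m-1)!\,H_{p}^{(m)}\right). \]
   Context: The Cauchy numbers $c_n$ are defined by $\frac{x}{\ln(1+x)}=\sum_{n\ge0}\frac{c_n}{n!}x^n$; equivalently $c_n=\int_0^1 z(z-1)\cdots(z-n+1)\,dz$. The signed Stirling numbers of the first kind $s(n,k)$ are defined by $z(z-1)\cdots(z-n+1)=\sum_{k=0}^n s(n,k)z^k$. $H_p^{(k)}=\sum_{i=1}^p i^{ -k}$ (with $H_0^{(k)}=0$) and $H_p=H_p^{(1)}$. $Y_m(t_1,\dots,t_m)$ is the exponential complete Bell polynomial, defined by $\exp\left(\sum_{j\ge1}t_j\frac{u^j}{j!}\right)=\sum_{m\ge0}Y_m(t_1,\dots,t_m)\frac{u^m}{m!}$ (so $Y_0=1$). The quantity $\hat c_p(-1)$ is the value at $-1$ of the Cauchy polynomial of the second kind. -}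

module Defs where

open import Data.Nat as ℕ using (ℕ; zero; suc; _!)
open import Data.Nat.Properties using (_!≢0)
open import Data.Nat.Combinatorics using (_C_)
open import Data.Integer as ℤ using (ℤ; +_)
open import Data.Rational using (ℚ; 0ℚ; 1ℚ; _+_; _*_; -_; _/_)

ℤ→ℚ : ℤ → ℚ
ℤ→ℚ z = z / 1

ℕ→ℚ : ℕ → ℚ
ℕ→ℚ n = (+ n) / 1

invFact : ℕ → ℚ
invFact n = (_/_ (+ 1) (n !)) {{n !≢0}}

invSuc : ℕ → ℚ
invSuc k = (+ 1) / suc k

negOnePow : ℕ → ℚ
negOnePow zero    = 1ℚ
negOnePow (suc k) = - negOnePow k

sumTo : ℕ → (ℕ → ℚ) → ℚ
sumTo zero    f = f 0
sumTo (suc n) f = sumTo n f + f (suc n)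

-- Σ_{i=a}^{b} f i  (empty, i.e. 0, when b < a)
sumFromLen : ℕ → ℕ → (ℕ → ℚ) → ℚ
sumFromLen a zero      f = 0ℚ
sumFromLen a (suc len) f = f a + sumFromLen (suc a) len f

sumFromTo : ℕ → ℕ → (ℕ → ℚ) → ℚ
sumFromTo a b f = sumFromLen a (suc b ℕ.∸ a) f

-- signed Stirling numbers of the first kind:
-- z(z-1)...(z-n+1) = Σ_k s(n,k) z^k, i.e. s(0,0)=1, s(0,k+1)=0,
-- s(n+1,0) = -n s(n,0), s(n+1,k+1) = s(n,k) - n s(n,k+1)
stirling1 : ℕ → ℕ → ℤ
stirling1 zero    zero    = + 1
stirling1 zero    (suc k) = + 0
stirling1 (suc n) zero    = ℤ.- ((+ n) ℤ.* stirling1 n zero)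
stirling1 (suc n) (suc k) = stirling1 n k ℤ.- ((+ n) ℤ.* stirling1 n (suc k))

s : ℕ → ℕ → ℚ
s n k = ℤ→ℚ (stirling1 n k)

-- Cauchy numbers c_n = ∫_0^1 z(z-1)...(z-n+1) dz = Σ_{k=0}^n s(n,k)/(k+1)
cauchy : ℕ → ℚ
cauchy n = sumTo n (λ k → s n k * invSuc k)

cauchyHat-1 : ℕ → ℚ
cauchyHat-1 p = sumTo p (λ k → s (suc p) (suc k) * negOnePow k * invSuc k)

powℚ : ℚ → ℕ → ℚ
powℚ x zero    = 1ℚ
powℚ x (suc k) = x * powℚ x k

H : ℕ → ℕ → ℚ
H p k = sumFromTo 1 p (λ i → powℚ (invSuc (i ℕ.∸ 1)) k)

Series : Set
Series = ℕ → ℚ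

one : Series
one zero    = 1ℚ
one (suc _) = 0ℚ

_⊛_ : Series → Series → Series
(f ⊛ g) n = sumTo n (λ i → f i * g (n ℕ.∸ i))

powS : Series → ℕ → Series
powS f zero    = one
powS f (suc j) = f ⊛ powS f j

-- exponential complete Bell polynomial:
-- exp(Σ_{j≥1} t_j u^j/j!) = Σ_m Y_m(t_1..t_m) u^m/m!.
-- With g(u) = Σ_{j≥1} t_j u^j/j! (no constant term), the coefficient of u^m in
-- exp(g) = Σ_{i≥0} g^i/i! only receives contributions from i ≤ m, so
-- Y_m = m! · [u^m] Σ_{i=0}^m g^i / i!.  Only t_1..t_m are used.
bellY : ℕ → (ℕ → ℚ) → ℚ
bellY m t = ℕ→ℚ (m !) * sumTo m (λ i → invFact i * powS g i m)
  where
  g : Series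
  g zero    = 0ℚ
  g (suc j) = t (suc j) * invFact (suc j)

{-# OPTIONS --safe #-}

-- With a_k(n) = s(n,k)/n!, both identities are about A(p,k) = Σ_n a_k(n) C(p,n).
-- Pascal's rule, absorption (n+1) C(p+1,n+1) = (p+1) C(p,n) and the Stirling
-- recurrence give A(p+1,k+1) = A(p,k+1) + A(p,k)/(p+1), the recurrence satisfied by
-- the coefficients of ∏_{i=1}^p (1 + u/i).  Hence (-1)^k A(p,k) is the coefficient of
-- u^k in P_p = ∏_{i=1}^p (1 - u/i) = (-1)^p/p! Σ_k s(p+1,k+1) u^k, and weighting by
-- 1/(k+1) gives the Cauchy-number identity.  For the Bell-polynomial identity, P_p has
-- logarithmic derivative -Σ_j H_p^(j+1) u^j, so P_p′ = G′ P_p for the series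
-- G = -Σ_j (j-1)! H_p^(j) u^j/j!; exp G satisfies the same first-order equation with
-- the same constant term, so P_p = exp G, whose m-th coefficient is Y_m/m!.

module Submission where

open import Defs
open import Data.Nat as ℕ using (ℕ; zero; suc; _∸_; _!; _≤_; _<_; z≤n; s≤s)
import Data.Nat.Properties as ℕₚ
open import Data.Nat.Combinatorics using (_C_; k>n⇒nCk≡0; nC1≡n; nCk+nC[k+1]≡[n+1]C[k+1])
open import Data.Integer as ℤ using (ℤ; 0ℤ; 1ℤ)
import Data.Integer.Properties as ℤₚ
open import Data.Rational using (ℚ; 0ℚ; 1ℚ; _+_; _*_; -_; _/_; toℚᵘ)
open import Data.Rational.Properties
import Data.Rational.Unnormalised as ℚᵘ
import Data.Rational.Unnormalised.Properties as ℚᵘₚ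
import Data.Rational.Solver
open import Data.Product using (_×_; _,_)
open import Data.Sum using (inj₁; inj₂)
open import Function using (_∘_)
open import Relation.Binary.PropositionalEquality
open import Algebra.Bundles using (CommutativeRing)
open import Algebra.Properties.CommutativeSemigroup (CommutativeRing.*-commutativeSemigroup +-*-commutativeRing)
  using (interchange; x∙yz≈y∙xz; x∙yz≈yx∙z; x∙yz≈xz∙y; xy∙z≈y∙xz)

open ≡-Reasoning
open Data.Rational.Solver.+-*-Solver

-- ℤ→ℚ normalises by a gcd, so its arithmetic is checked on unnormalised fractions,
-- where ℤ→ℚ z becomes literally z/1.
toℚᵘ-ℤ→ℚ : ∀ z → toℚᵘ (ℤ→ℚ z) ℚᵘ.≃ ℚᵘ.mkℚᵘ z 0
toℚᵘ-ℤ→ℚ z = toℚᵘ-fromℚᵘ (ℚᵘ.mkℚᵘ z 0)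

ℤ→ℚ-+ : ∀ a b → ℤ→ℚ (a ℤ.+ b) ≡ ℤ→ℚ a + ℤ→ℚ b
ℤ→ℚ-+ a b = toℚᵘ-injective (ℚᵘₚ.≃-trans (toℚᵘ-ℤ→ℚ (a ℤ.+ b)) (ℚᵘₚ.≃-sym
  (ℚᵘₚ.≃-trans (toℚᵘ-homo-+ (ℤ→ℚ a) (ℤ→ℚ b))
    (ℚᵘₚ.≃-trans (ℚᵘₚ.+-cong (toℚᵘ-ℤ→ℚ a) (toℚᵘ-ℤ→ℚ b)) (ℚᵘ.*≡* eq)))))
  where
  eq : (a ℤ.* 1ℤ ℤ.+ b ℤ.* 1ℤ) ℤ.* 1ℤ ≡ (a ℤ.+ b) ℤ.* 1ℤ
  eq = begin
    (a ℤ.* 1ℤ ℤ.+ b ℤ.* 1ℤ) ℤ.* 1ℤ  ≡⟨ ℤₚ.*-identityʳ _ ⟩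
    a ℤ.* 1ℤ ℤ.+ b ℤ.* 1ℤ           ≡⟨ cong₂ ℤ._+_ (ℤₚ.*-identityʳ a) (ℤₚ.*-identityʳ b) ⟩
    a ℤ.+ b                         ≡⟨ ℤₚ.*-identityʳ (a ℤ.+ b) ⟨
    (a ℤ.+ b) ℤ.* 1ℤ                ∎

ℤ→ℚ-* : ∀ a b → ℤ→ℚ (a ℤ.* b) ≡ ℤ→ℚ a * ℤ→ℚ b
ℤ→ℚ-* a b = toℚᵘ-injective (ℚᵘₚ.≃-trans (toℚᵘ-ℤ→ℚ (a ℤ.* b)) (ℚᵘₚ.≃-sym
  (ℚᵘₚ.≃-trans (toℚᵘ-homo-* (ℤ→ℚ a) (ℤ→ℚ b))
    (ℚᵘₚ.≃-trans (ℚᵘₚ.*-cong (toℚᵘ-ℤ→ℚ a) (toℚᵘ-ℤ→ℚ b)) (ℚᵘ.*≡* refl)))))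

ℤ→ℚ-neg : ∀ a → ℤ→ℚ (ℤ.- a) ≡ - ℤ→ℚ a
ℤ→ℚ-neg a = toℚᵘ-injective (ℚᵘₚ.≃-trans (toℚᵘ-ℤ→ℚ (ℤ.- a)) (ℚᵘₚ.≃-sym
  (ℚᵘₚ.≃-trans (toℚᵘ-homo‿- (ℤ→ℚ a))
    (ℚᵘₚ.≃-trans (ℚᵘₚ.-‿cong (toℚᵘ-ℤ→ℚ a)) (ℚᵘ.*≡* refl)))))

ℕ→ℚ-+ : ∀ m n → ℕ→ℚ (m ℕ.+ n) ≡ ℕ→ℚ m + ℕ→ℚ n
ℕ→ℚ-+ m n = trans (cong ℤ→ℚ (ℤₚ.pos-+ m n)) (ℤ→ℚ-+ (ℤ.+ m) (ℤ.+ n))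

ℕ→ℚ-* : ∀ m n → ℕ→ℚ (m ℕ.* n) ≡ ℕ→ℚ m * ℕ→ℚ n
ℕ→ℚ-* m n = trans (cong ℤ→ℚ (ℤₚ.pos-* m n)) (ℤ→ℚ-* (ℤ.+ m) (ℤ.+ n))

1/n*n≡1 : ∀ n .{{_ : ℕ.NonZero n}} → (ℤ.+ 1 / n) * ℕ→ℚ n ≡ 1ℚ
1/n*n≡1 (suc n) = toℚᵘ-injective (ℚᵘₚ.≃-trans (toℚᵘ-homo-* (ℤ.+ 1 / suc n) (ℕ→ℚ (suc n)))
  (ℚᵘₚ.≃-trans (ℚᵘₚ.*-cong (toℚᵘ-fromℚᵘ (ℚᵘ.mkℚᵘ (ℤ.+ 1) n)) (toℚᵘ-ℤ→ℚ (ℤ.+ suc n)))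
    (ℚᵘ.*≡* eq)))
  where
  eq : (1ℤ ℤ.* ℤ.+ suc n) ℤ.* 1ℤ ≡ 1ℤ ℤ.* (ℤ.+ suc n ℤ.* 1ℤ)
  eq = trans (ℤₚ.*-identityʳ _) (cong (1ℤ ℤ.*_) (sym (ℤₚ.*-identityʳ (ℤ.+ suc n))))

invSuc-inverseˡ : ∀ n → invSuc n * ℕ→ℚ (suc n) ≡ 1ℚ
invSuc-inverseˡ n = 1/n*n≡1 (suc n)

invFact-inverseˡ : ∀ n → invFact n * ℕ→ℚ (n !) ≡ 1ℚ
invFact-inverseˡ n = 1/n*n≡1 (n !) {{n ℕₚ.!≢0}}

*-inverse-unique : ∀ {x y a} → x * a ≡ 1ℚ → y * a ≡ 1ℚ → x ≡ y
*-inverse-unique {x} {y} {a} xa≡1 ya≡1 = begin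
  x            ≡⟨ *-identityʳ x ⟨
  x * 1ℚ       ≡⟨ cong (x *_) ya≡1 ⟨
  x * (y * a)  ≡⟨ x∙yz≈xz∙y x y a ⟩
  (x * a) * y  ≡⟨ cong (_* y) xa≡1 ⟩
  1ℚ * y       ≡⟨ *-identityˡ y ⟩
  y            ∎

invFact-suc : ∀ n → invFact (suc n) ≡ invSuc n * invFact n
invFact-suc n = *-inverse-unique (invFact-inverseˡ (suc n)) (begin
  invSuc n * invFact n * ℕ→ℚ (suc n ℕ.* n !)
    ≡⟨ cong (invSuc n * invFact n *_) (ℕ→ℚ-* (suc n) (n !)) ⟩
  invSuc n * invFact n * (ℕ→ℚ (suc n) * ℕ→ℚ (n !))
    ≡⟨ interchange (invSuc n) (invFact n) (ℕ→ℚ (suc n)) (ℕ→ℚ (n !)) ⟩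
  (invSuc n * ℕ→ℚ (suc n)) * (invFact n * ℕ→ℚ (n !))
    ≡⟨ cong₂ _*_ (invSuc-inverseˡ n) (invFact-inverseˡ n) ⟩
  1ℚ ∎)

suc*invFact-suc : ∀ n → ℕ→ℚ (suc n) * invFact (suc n) ≡ invFact n
suc*invFact-suc n = begin
  ℕ→ℚ (suc n) * invFact (suc n)
    ≡⟨ cong (ℕ→ℚ (suc n) *_) (invFact-suc n) ⟩
  ℕ→ℚ (suc n) * (invSuc n * invFact n)
    ≡⟨ *-assoc (ℕ→ℚ (suc n)) (invSuc n) (invFact n) ⟨
  ℕ→ℚ (suc n) * invSuc n * invFact n
    ≡⟨ cong (_* invFact n) (trans (*-comm (ℕ→ℚ (suc n)) (invSuc n)) (invSuc-inverseˡ n)) ⟩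
  1ℚ * invFact n
    ≡⟨ *-identityˡ (invFact n) ⟩
  invFact n ∎

suc*x≡y⇒x≡invSuc*y : ∀ n {x y} → ℕ→ℚ (suc n) * x ≡ y → x ≡ invSuc n * y
suc*x≡y⇒x≡invSuc*y n {x} {y} eq = begin
  x                             ≡⟨ *-identityˡ x ⟨
  1ℚ * x                        ≡⟨ cong (_* x) (invSuc-inverseˡ n) ⟨
  invSuc n * ℕ→ℚ (suc n) * x    ≡⟨ *-assoc (invSuc n) _ x ⟩
  invSuc n * (ℕ→ℚ (suc n) * x)  ≡⟨ cong (invSuc n *_) eq ⟩
  invSuc n * y                  ∎

sumTo-cong : ∀ n {f g : ℕ → ℚ} → (∀ i → i ≤ n → f i ≡ g i) → sumTo n f ≡ sumTo n g
sumTo-cong zero    f≡g = f≡g 0 z≤n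
sumTo-cong (suc n) f≡g =
  cong₂ _+_ (sumTo-cong n (λ i i≤n → f≡g i (ℕₚ.m≤n⇒m≤1+n i≤n))) (f≡g (suc n) ℕₚ.≤-refl)

sumTo-zero : ∀ n {f : ℕ → ℚ} → (∀ i → i ≤ n → f i ≡ 0ℚ) → sumTo n f ≡ 0ℚ
sumTo-zero zero    f≡0 = f≡0 0 z≤n
sumTo-zero (suc n) f≡0 =
  cong₂ _+_ (sumTo-zero n (λ i i≤n → f≡0 i (ℕₚ.m≤n⇒m≤1+n i≤n))) (f≡0 (suc n) ℕₚ.≤-refl)

sumTo-+ : ∀ n (f g : ℕ → ℚ) → sumTo n (λ i → f i + g i) ≡ sumTo n f + sumTo n g
sumTo-+ zero    f g = refl
sumTo-+ (suc n) f g = begin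
  sumTo n (λ i → f i + g i) + (f (suc n) + g (suc n))
    ≡⟨ cong (_+ (f (suc n) + g (suc n))) (sumTo-+ n f g) ⟩
  sumTo n f + sumTo n g + (f (suc n) + g (suc n))
    ≡⟨ solve 4 (λ a b c d → a :+ b :+ (c :+ d) := a :+ c :+ (b :+ d)) refl
         (sumTo n f) (sumTo n g) (f (suc n)) (g (suc n)) ⟩
  sumTo n f + f (suc n) + (sumTo n g + g (suc n)) ∎

sumTo-*ˡ : ∀ n c (f : ℕ → ℚ) → sumTo n (λ i → c * f i) ≡ c * sumTo n f
sumTo-*ˡ zero    c f = refl
sumTo-*ˡ (suc n) c f =
  trans (cong (_+ c * f (suc n)) (sumTo-*ˡ n c f)) (sym (*-distribˡ-+ c (sumTo n f) (f (suc n))))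

sumTo-*ʳ : ∀ n c (f : ℕ → ℚ) → sumTo n (λ i → f i * c) ≡ sumTo n f * c
sumTo-*ʳ n c f = begin
  sumTo n (λ i → f i * c) ≡⟨ sumTo-cong n (λ i _ → *-comm (f i) c) ⟩
  sumTo n (λ i → c * f i) ≡⟨ sumTo-*ˡ n c f ⟩
  c * sumTo n f           ≡⟨ *-comm c (sumTo n f) ⟩
  sumTo n f * c           ∎

sumTo-suc-head : ∀ n (f : ℕ → ℚ) → sumTo (suc n) f ≡ f 0 + sumTo n (λ i → f (suc i))
sumTo-suc-head zero    f = refl
sumTo-suc-head (suc n) f =
  trans (cong (_+ f (suc (suc n))) (sumTo-suc-head n f)) (+-assoc (f 0) _ _)

sumTo-extend : ∀ m n {f : ℕ → ℚ} → m ≤ n → (∀ i → m < i → i ≤ n → f i ≡ 0ℚ) →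
               sumTo m f ≡ sumTo n f
sumTo-extend m zero    z≤n   f≡0 = refl
sumTo-extend m (suc n) {f} m≤1+n f≡0 with ℕₚ.m≤n⇒m<n∨m≡n m≤1+n
... | inj₂ refl          = refl
... | inj₁ (s≤s m≤n) = begin
  sumTo m f               ≡⟨ sumTo-extend m n m≤n (λ i m<i i≤n → f≡0 i m<i (ℕₚ.m≤n⇒m≤1+n i≤n)) ⟩
  sumTo n f               ≡⟨ +-identityʳ (sumTo n f) ⟨
  sumTo n f + 0ℚ          ≡⟨ cong (sumTo n f +_) (f≡0 (suc n) (s≤s m≤n) ℕₚ.≤-refl) ⟨
  sumTo n f + f (suc n)   ∎

sumTo-reverse : ∀ n (f : ℕ → ℚ) → sumTo n f ≡ sumTo n (λ i → f (n ∸ i))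
sumTo-reverse zero    f = refl
sumTo-reverse (suc n) f = begin
  sumTo n f + f (suc n)                   ≡⟨ +-comm (sumTo n f) (f (suc n)) ⟩
  f (suc n) + sumTo n f                   ≡⟨ cong (f (suc n) +_) (sumTo-reverse n f) ⟩
  f (suc n) + sumTo n (λ i → f (n ∸ i))   ≡⟨ sumTo-suc-head n (λ i → f (suc n ∸ i)) ⟨
  sumTo (suc n) (λ i → f (suc n ∸ i))     ∎

sumTo-swap : ∀ m n (F : ℕ → ℕ → ℚ) →
             sumTo m (λ i → sumTo n (F i)) ≡ sumTo n (λ j → sumTo m (λ i → F i j))
sumTo-swap zero    n F = refl
sumTo-swap (suc m) n F = begin
  sumTo m (λ i → sumTo n (F i)) + sumTo n (F (suc m))
    ≡⟨ cong (_+ sumTo n (F (suc m))) (sumTo-swap m n F) ⟩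
  sumTo n (λ j → sumTo m (λ i → F i j)) + sumTo n (F (suc m))
    ≡⟨ sumTo-+ n (λ j → sumTo m (λ i → F i j)) (F (suc m)) ⟨
  sumTo n (λ j → sumTo m (λ i → F i j) + F (suc m) j) ∎

sumTo-triangle : ∀ n (F : ℕ → ℕ → ℚ) →
  sumTo n (λ a → sumTo a (λ b → F b (a ∸ b))) ≡ sumTo n (λ b → sumTo (n ∸ b) (F b))
sumTo-triangle zero    F = refl
sumTo-triangle (suc n) F = begin
  sumTo n (λ a → sumTo a (λ b → F b (a ∸ b))) + sumTo (suc n) (λ b → F b (suc n ∸ b))
    ≡⟨ cong (_+ sumTo (suc n) (λ b → F b (suc n ∸ b))) (sumTo-triangle n F) ⟩
  sumTo n (λ b → sumTo (n ∸ b) (F b)) + (sumTo n (λ b → F b (suc n ∸ b)) + F (suc n) (n ∸ n))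
    ≡⟨ +-assoc (sumTo n (λ b → sumTo (n ∸ b) (F b))) _ _ ⟨
  sumTo n (λ b → sumTo (n ∸ b) (F b)) + sumTo n (λ b → F b (suc n ∸ b)) + F (suc n) (n ∸ n)
    ≡⟨ cong (_+ F (suc n) (n ∸ n)) (sumTo-+ n (λ b → sumTo (n ∸ b) (F b)) (λ b → F b (suc n ∸ b))) ⟨
  sumTo n (λ b → sumTo (n ∸ b) (F b) + F b (suc n ∸ b)) + F (suc n) (n ∸ n)
    ≡⟨ cong (_+ F (suc n) (n ∸ n)) (sumTo-cong n row) ⟩
  sumTo n (λ b → sumTo (suc n ∸ b) (F b)) + F (suc n) (n ∸ n)
    ≡⟨ cong (sumTo n (λ b → sumTo (suc n ∸ b) (F b)) +_) (lastRow n) ⟩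
  sumTo n (λ b → sumTo (suc n ∸ b) (F b)) + sumTo (n ∸ n) (F (suc n)) ∎
  where
  row : ∀ b → b ≤ n → sumTo (n ∸ b) (F b) + F b (suc n ∸ b) ≡ sumTo (suc n ∸ b) (F b)
  row b b≤n rewrite ℕₚ.+-∸-assoc 1 b≤n = refl
  lastRow : ∀ n → F (suc n) (n ∸ n) ≡ sumTo (n ∸ n) (F (suc n))
  lastRow n rewrite ℕₚ.n∸n≡0 n = refl

D : Series → Series
D f n = ℕ→ℚ (suc n) * f (suc n)

⊛-cong : ∀ {f f′ g g′ : Series} → f ≗ f′ → g ≗ g′ → f ⊛ g ≗ f′ ⊛ g′
⊛-cong f≗f′ g≗g′ n = sumTo-cong n (λ i _ → cong₂ _*_ (f≗f′ i) (g≗g′ (n ∸ i)))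

⊛-comm : ∀ (f g : Series) → f ⊛ g ≗ g ⊛ f
⊛-comm f g n = begin
  sumTo n (λ i → f i * g (n ∸ i))              ≡⟨ sumTo-reverse n _ ⟩
  sumTo n (λ i → f (n ∸ i) * g (n ∸ (n ∸ i)))  ≡⟨ sumTo-cong n swapped ⟩
  sumTo n (λ i → g i * f (n ∸ i))              ∎
  where
  swapped : ∀ i → i ≤ n → f (n ∸ i) * g (n ∸ (n ∸ i)) ≡ g i * f (n ∸ i)
  swapped i i≤n = trans (cong (λ j → f (n ∸ i) * g j) (ℕₚ.m∸[m∸n]≡n i≤n)) (*-comm (f (n ∸ i)) (g i))

⊛-assoc : ∀ (f g h : Series) → (f ⊛ g) ⊛ h ≗ f ⊛ (g ⊛ h)
⊛-assoc f g h n = begin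
  sumTo n (λ a → sumTo a (λ b → f b * g (a ∸ b)) * h (n ∸ a))
    ≡⟨ sumTo-cong n (λ a _ → sym (sumTo-*ʳ a (h (n ∸ a)) _)) ⟩
  sumTo n (λ a → sumTo a (λ b → f b * g (a ∸ b) * h (n ∸ a)))
    ≡⟨ sumTo-cong n (λ a _ → sumTo-cong a (λ b b≤a → cong (λ j → f b * g (a ∸ b) * h j) (rest a b b≤a))) ⟩
  sumTo n (λ a → sumTo a (λ b → F b (a ∸ b)))
    ≡⟨ sumTo-triangle n F ⟩
  sumTo n (λ b → sumTo (n ∸ b) (F b))
    ≡⟨ sumTo-cong n (λ b _ → trans (sumTo-cong (n ∸ b) (λ c _ → *-assoc (f b) (g c) _)) (sumTo-*ˡ (n ∸ b) (f b) _)) ⟩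
  sumTo n (λ b → f b * sumTo (n ∸ b) (λ c → g c * h (n ∸ b ∸ c))) ∎
  where
  F : ℕ → ℕ → ℚ
  F b c = f b * g c * h (n ∸ b ∸ c)
  rest : ∀ a b → b ≤ a → n ∸ a ≡ n ∸ b ∸ (a ∸ b)
  rest a b b≤a = trans (cong (n ∸_) (sym (ℕₚ.m+[n∸m]≡n b≤a))) (sym (ℕₚ.∸-+-assoc n b (a ∸ b)))

f⊛[g⊛h]≗g⊛[f⊛h] : ∀ (f g h : Series) → f ⊛ (g ⊛ h) ≗ g ⊛ (f ⊛ h)
f⊛[g⊛h]≗g⊛[f⊛h] f g h n = begin
  (f ⊛ (g ⊛ h)) n  ≡⟨ ⊛-assoc f g h n ⟨
  ((f ⊛ g) ⊛ h) n  ≡⟨ ⊛-cong (⊛-comm f g) (λ i → refl {x = h i}) n ⟩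
  ((g ⊛ f) ⊛ h) n  ≡⟨ ⊛-assoc g f h n ⟩
  (g ⊛ (f ⊛ h)) n  ∎

⊛-distribʳ-+ : ∀ (f g h : Series) n → ((λ i → f i + g i) ⊛ h) n ≡ (f ⊛ h) n + (g ⊛ h) n
⊛-distribʳ-+ f g h n =
  trans (sumTo-cong n (λ i _ → *-distribʳ-+ (h (n ∸ i)) (f i) (g i))) (sumTo-+ n _ _)

⊛-scaleʳ : ∀ (f g : Series) c n → (f ⊛ (λ i → c * g i)) n ≡ c * (f ⊛ g) n
⊛-scaleʳ f g c n = trans (sumTo-cong n (λ i _ → x∙yz≈y∙xz (f i) c (g (n ∸ i)))) (sumTo-*ˡ n c _)

⊛-zeroʳ : ∀ (f g : Series) → (∀ i → g i ≡ 0ℚ) → ∀ n → (f ⊛ g) n ≡ 0ℚ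
⊛-zeroʳ f g g≡0 n = sumTo-zero n (λ i _ → trans (cong (f i *_) (g≡0 (n ∸ i))) (*-zeroʳ (f i)))

powS-cong : ∀ {f f′ : Series} → f ≗ f′ → ∀ i → powS f i ≗ powS f′ i
powS-cong f≗f′ zero    n = refl
powS-cong f≗f′ (suc i) n = ⊛-cong f≗f′ (powS-cong f≗f′ i) n

D-one : ∀ n → D one n ≡ 0ℚ
D-one n = *-zeroʳ (ℕ→ℚ (suc n))

D-⊛ : ∀ (f g : Series) n → D (f ⊛ g) n ≡ (D f ⊛ g) n + (f ⊛ D g) n
D-⊛ f g n = begin
  ℕ→ℚ (suc n) * sumTo (suc n) (λ i → f i * g (suc n ∸ i))
    ≡⟨ sumTo-*ˡ (suc n) (ℕ→ℚ (suc n)) _ ⟨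
  sumTo (suc n) (λ i → ℕ→ℚ (suc n) * (f i * g (suc n ∸ i)))
    ≡⟨ sumTo-cong (suc n) split ⟩
  sumTo (suc n) (λ i → ℕ→ℚ i * f i * g (suc n ∸ i) + f i * weighted g (suc n ∸ i))
    ≡⟨ sumTo-+ (suc n) _ _ ⟩
  sumTo (suc n) (λ i → ℕ→ℚ i * f i * g (suc n ∸ i)) + sumTo (suc n) (λ i → f i * weighted g (suc n ∸ i))
    ≡⟨ cong₂ _+_ left right ⟩
  (D f ⊛ g) n + (f ⊛ D g) n ∎
  where
  weighted : Series → Series
  weighted h j = ℕ→ℚ j * h j
  split : ∀ i → i ≤ suc n →
    ℕ→ℚ (suc n) * (f i * g (suc n ∸ i)) ≡ ℕ→ℚ i * f i * g (suc n ∸ i) + f i * weighted g (suc n ∸ i)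
  split i i≤1+n = begin
    ℕ→ℚ (suc n) * (f i * g j)             ≡⟨ cong (λ m → ℕ→ℚ m * (f i * g j)) (ℕₚ.m+[n∸m]≡n i≤1+n) ⟨
    ℕ→ℚ (i ℕ.+ j) * (f i * g j)           ≡⟨ cong (_* (f i * g j)) (ℕ→ℚ-+ i j) ⟩
    (ℕ→ℚ i + ℕ→ℚ j) * (f i * g j)         ≡⟨ solve 4 (λ a b x y → (a :+ b) :* (x :* y) := a :* x :* y :+ x :* (b :* y))
                                                refl (ℕ→ℚ i) (ℕ→ℚ j) (f i) (g j) ⟩
    ℕ→ℚ i * f i * g j + f i * (ℕ→ℚ j * g j) ∎
    where j = suc n ∸ i
  left : sumTo (suc n) (λ i → ℕ→ℚ i * f i * g (suc n ∸ i)) ≡ (D f ⊛ g) n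
  left = begin
    sumTo (suc n) (λ i → ℕ→ℚ i * f i * g (suc n ∸ i))
      ≡⟨ sumTo-suc-head n _ ⟩
    0ℚ * f 0 * g (suc n) + (D f ⊛ g) n
      ≡⟨ cong (_+ (D f ⊛ g) n) (trans (cong (_* g (suc n)) (*-zeroˡ (f 0))) (*-zeroˡ (g (suc n)))) ⟩
    0ℚ + (D f ⊛ g) n
      ≡⟨ +-identityˡ _ ⟩
    (D f ⊛ g) n ∎
  right : sumTo (suc n) (λ i → f i * weighted g (suc n ∸ i)) ≡ (f ⊛ D g) n
  right = begin
    sumTo n (λ i → f i * weighted g (suc n ∸ i)) + f (suc n) * weighted g (n ∸ n)
      ≡⟨ cong₂ _+_ (sumTo-cong n (λ i i≤n → cong (λ j → f i * weighted g j) (ℕₚ.+-∸-assoc 1 i≤n)))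
                   (cong (λ j → f (suc n) * weighted g j) (ℕₚ.n∸n≡0 n)) ⟩
    (f ⊛ D g) n + f (suc n) * (0ℚ * g 0)
      ≡⟨ cong ((f ⊛ D g) n +_) (trans (cong (f (suc n) *_) (*-zeroˡ (g 0))) (*-zeroʳ (f (suc n)))) ⟩
    (f ⊛ D g) n + 0ℚ
      ≡⟨ +-identityʳ _ ⟩
    (f ⊛ D g) n ∎

D-unique : ∀ (h E F : Series) → E 0 ≡ F 0 →
           (∀ n → D E n ≡ (h ⊛ E) n) → (∀ n → D F n ≡ (h ⊛ F) n) → E ≗ F
D-unique h E F E0≡F0 E′≡hE F′≡hF n = agreeUpTo n n ℕₚ.≤-refl
  where
  agreeUpTo : ∀ n k → k ≤ n → E k ≡ F k
  agreeUpTo zero    .zero z≤n = E0≡F0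
  agreeUpTo (suc n) k k≤1+n with ℕₚ.m≤n⇒m<n∨m≡n k≤1+n
  ... | inj₁ (s≤s k≤n) = agreeUpTo n k k≤n
  ... | inj₂ refl      = begin
    E (suc n)
      ≡⟨ suc*x≡y⇒x≡invSuc*y n (E′≡hE n) ⟩
    invSuc n * (h ⊛ E) n
      ≡⟨ cong (invSuc n *_) (sumTo-cong n (λ i _ → cong (h i *_) (agreeUpTo n (n ∸ i) (ℕₚ.m∸n≤m n i)))) ⟩
    invSuc n * (h ⊛ F) n
      ≡⟨ suc*x≡y⇒x≡invSuc*y n (F′≡hF n) ⟨
    F (suc n) ∎

-- Truncating Σ_i G^i/i! at i = n is exact at u^n once G 0 = 0 (see powS-vanish).
expS : Series → Series
expS G n = sumTo n (λ i → invFact i * powS G i n)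

powS-vanish : ∀ {G : Series} → G 0 ≡ 0ℚ → ∀ i n → n < i → powS G i n ≡ 0ℚ
powS-vanish {G} G0≡0 (suc i) n (s≤s n≤i) = sumTo-zero n term
  where
  term : ∀ a → a ≤ n → G a * powS G i (n ∸ a) ≡ 0ℚ
  term zero    _ = trans (cong (_* powS G i n) G0≡0) (*-zeroˡ (powS G i n))
  term (suc a) 1+a≤n = trans (cong (G (suc a) *_) (powS-vanish G0≡0 i (n ∸ suc a) n∸[1+a]<i)) (*-zeroʳ (G (suc a)))
    where n∸[1+a]<i = ℕₚ.<-≤-trans (ℕₚ.∸-monoʳ-< (s≤s z≤n) 1+a≤n) n≤i

D-powS : ∀ (G : Series) i n → D (powS G (suc i)) n ≡ ℕ→ℚ (suc i) * (D G ⊛ powS G i) n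
D-powS G zero    n = begin
  D (G ⊛ one) n                   ≡⟨ D-⊛ G one n ⟩
  (D G ⊛ one) n + (G ⊛ D one) n   ≡⟨ cong ((D G ⊛ one) n +_) (⊛-zeroʳ G (D one) D-one n) ⟩
  (D G ⊛ one) n + 0ℚ              ≡⟨ +-identityʳ _ ⟩
  (D G ⊛ one) n                   ≡⟨ *-identityˡ _ ⟨
  1ℚ * (D G ⊛ one) n              ∎
D-powS G (suc i) n = begin
  D (G ⊛ powS G (suc i)) n
    ≡⟨ D-⊛ G (powS G (suc i)) n ⟩
  X + (G ⊛ D (powS G (suc i))) n
    ≡⟨ cong (X +_) (⊛-cong (λ j → refl {x = G j}) (D-powS G i) n) ⟩
  X + (G ⊛ (λ k → ℕ→ℚ (suc i) * (D G ⊛ powS G i) k)) n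
    ≡⟨ cong (X +_) (⊛-scaleʳ G (D G ⊛ powS G i) (ℕ→ℚ (suc i)) n) ⟩
  X + ℕ→ℚ (suc i) * (G ⊛ (D G ⊛ powS G i)) n
    ≡⟨ cong (λ Y → X + ℕ→ℚ (suc i) * Y) (f⊛[g⊛h]≗g⊛[f⊛h] G (D G) (powS G i) n) ⟩
  X + ℕ→ℚ (suc i) * X
    ≡⟨ solve 2 (λ x a → x :+ a :* x := (con 1ℚ :+ a) :* x) refl X (ℕ→ℚ (suc i)) ⟩
  (1ℚ + ℕ→ℚ (suc i)) * X
    ≡⟨ cong (_* X) (ℕ→ℚ-+ 1 (suc i)) ⟨
  ℕ→ℚ (suc (suc i)) * X ∎
  where
  X = (D G ⊛ powS G (suc i)) n

D-expS : ∀ {G : Series} → G 0 ≡ 0ℚ → ∀ n → D (expS G) n ≡ (D G ⊛ expS G) n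
D-expS {G} G0≡0 n = begin
  ℕ→ℚ (suc n) * sumTo (suc n) (λ i → invFact i * powS G i (suc n))
    ≡⟨ sumTo-*ˡ (suc n) (ℕ→ℚ (suc n)) _ ⟨
  sumTo (suc n) (λ i → ℕ→ℚ (suc n) * (invFact i * powS G i (suc n)))
    ≡⟨ sumTo-suc-head n _ ⟩
  ℕ→ℚ (suc n) * (1ℚ * 0ℚ) + sumTo n (λ i → ℕ→ℚ (suc n) * (invFact (suc i) * powS G (suc i) (suc n)))
    ≡⟨ cong₂ _+_ (*-zeroʳ (ℕ→ℚ (suc n))) (sumTo-cong n (λ i _ → term i)) ⟩
  0ℚ + sumTo n (λ i → invFact i * (D G ⊛ powS G i) n)
    ≡⟨ +-identityˡ _ ⟩
  sumTo n (λ i → invFact i * (D G ⊛ powS G i) n)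
    ≡⟨ sumTo-cong n (λ i _ → sumTo-*ˡ n (invFact i) _) ⟨
  sumTo n (λ i → sumTo n (λ a → invFact i * (D G a * powS G i (n ∸ a))))
    ≡⟨ sumTo-swap n n _ ⟩
  sumTo n (λ a → sumTo n (λ i → invFact i * (D G a * powS G i (n ∸ a))))
    ≡⟨ sumTo-cong n (λ a _ → trans (sumTo-cong n (λ i _ → x∙yz≈y∙xz (invFact i) (D G a) _)) (sumTo-*ˡ n (D G a) _)) ⟩
  sumTo n (λ a → D G a * sumTo n (λ i → invFact i * powS G i (n ∸ a)))
    ≡⟨ sumTo-cong n (λ a _ → cong (D G a *_) (truncate a)) ⟨
  (D G ⊛ expS G) n ∎
  where
  term : ∀ i → ℕ→ℚ (suc n) * (invFact (suc i) * powS G (suc i) (suc n)) ≡ invFact i * (D G ⊛ powS G i) n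
  term i = begin
    ℕ→ℚ (suc n) * (invFact (suc i) * powS G (suc i) (suc n)) ≡⟨ x∙yz≈y∙xz (ℕ→ℚ (suc n)) (invFact (suc i)) _ ⟩
    invFact (suc i) * D (powS G (suc i)) n                   ≡⟨ cong (invFact (suc i) *_) (D-powS G i n) ⟩
    invFact (suc i) * (ℕ→ℚ (suc i) * (D G ⊛ powS G i) n)     ≡⟨ x∙yz≈yx∙z (invFact (suc i)) (ℕ→ℚ (suc i)) _ ⟩
    ℕ→ℚ (suc i) * invFact (suc i) * (D G ⊛ powS G i) n       ≡⟨ cong (_* (D G ⊛ powS G i) n) (suc*invFact-suc i) ⟩
    invFact i * (D G ⊛ powS G i) n                           ∎
  truncate : ∀ a → expS G (n ∸ a) ≡ sumTo n (λ i → invFact i * powS G i (n ∸ a))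
  truncate a = sumTo-extend (n ∸ a) n (ℕₚ.m∸n≤m n a)
    (λ i n∸a<i _ → trans (cong (invFact i *_) (powS-vanish G0≡0 i (n ∸ a) n∸a<i)) (*-zeroʳ (invFact i)))

bellSeries : (ℕ → ℚ) → Series
bellSeries t zero    = 0ℚ
bellSeries t (suc j) = t (suc j) * invFact (suc j)

bellY≡m!*expS : ∀ m t → bellY m t ≡ ℕ→ℚ (m !) * expS (bellSeries t) m
bellY≡m!*expS m t = cong (ℕ→ℚ (m !) *_) (sumTo-cong m (λ i _ →
  cong (invFact i *_) (powS-cong (λ { zero → refl ; (suc j) → refl }) i m)))

D-bellSeries : ∀ t n → D (bellSeries t) n ≡ t (suc n) * invFact n
D-bellSeries t n = trans (x∙yz≈y∙xz (ℕ→ℚ (suc n)) (t (suc n)) (invFact (suc n)))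
                         (cong (t (suc n) *_) (suc*invFact-suc n))

s-suc-zero : ∀ n → s (suc n) 0 ≡ 0ℚ
s-suc-zero n = cong ℤ→ℚ (stirling1-suc-zero n)
  where
  stirling1-suc-zero : ∀ n → stirling1 (suc n) 0 ≡ 0ℤ
  stirling1-suc-zero zero    = refl
  stirling1-suc-zero (suc n) rewrite stirling1-suc-zero n | ℤₚ.*-zeroʳ (ℤ.+ suc n) = refl

s-above : ∀ {n k} → n < k → s n k ≡ 0ℚ
s-above n<k = cong ℤ→ℚ (stirling1-above n<k)
  where
  stirling1-above : ∀ {n k} → n < k → stirling1 n k ≡ 0ℤ
  stirling1-above {zero}  {suc k} _         = refl
  stirling1-above {suc n} {suc k} (s≤s n<k)
    rewrite stirling1-above n<k | stirling1-above (ℕₚ.m<n⇒m<1+n n<k) | ℤₚ.*-zeroʳ (ℤ.+ n) = refl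

s-suc-suc : ∀ n k → s (suc n) (suc k) ≡ s n k + - (ℕ→ℚ n * s n (suc k))
s-suc-suc n k = trans (ℤ→ℚ-+ (stirling1 n k) (ℤ.- (ℤ.+ n ℤ.* stirling1 n (suc k))))
  (cong (s n k +_) (trans (ℤ→ℚ-neg (ℤ.+ n ℤ.* stirling1 n (suc k))) (cong -_ (ℤ→ℚ-* (ℤ.+ n) (stirling1 n (suc k))))))

[k+1]*[n+1]C[k+1]≡[n+1]*nCk : ∀ n k → suc k ℕ.* (suc n C suc k) ≡ suc n ℕ.* (n C k)
[k+1]*[n+1]C[k+1]≡[n+1]*nCk zero    zero    = refl
[k+1]*[n+1]C[k+1]≡[n+1]*nCk zero    (suc k) =
  trans (cong (suc (suc k) ℕ.*_) (k>n⇒nCk≡0 {1} {suc (suc k)} (s≤s (s≤s z≤n)))) (ℕₚ.*-zeroʳ (suc (suc k)))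
[k+1]*[n+1]C[k+1]≡[n+1]*nCk (suc n) zero    =
  trans (ℕₚ.*-identityˡ _) (trans (nC1≡n (suc (suc n))) (sym (ℕₚ.*-identityʳ (suc (suc n)))))
[k+1]*[n+1]C[k+1]≡[n+1]*nCk (suc n) (suc k) = begin
  suc (suc k) ℕ.* (suc (suc n) C suc (suc k))
    ≡⟨ cong (suc (suc k) ℕ.*_) (nCk+nC[k+1]≡[n+1]C[k+1] (suc n) (suc k)) ⟨
  suc (suc k) ℕ.* (a ℕ.+ b)
    ≡⟨ ℕₚ.*-distribˡ-+ (suc (suc k)) a b ⟩
  a ℕ.+ suc k ℕ.* a ℕ.+ suc (suc k) ℕ.* b
    ≡⟨ ℕₚ.+-assoc a (suc k ℕ.* a) (suc (suc k) ℕ.* b) ⟩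
  a ℕ.+ (suc k ℕ.* a ℕ.+ suc (suc k) ℕ.* b)
    ≡⟨ cong (a ℕ.+_) (cong₂ ℕ._+_ ([k+1]*[n+1]C[k+1]≡[n+1]*nCk n k) ([k+1]*[n+1]C[k+1]≡[n+1]*nCk n (suc k))) ⟩
  a ℕ.+ (suc n ℕ.* (n C k) ℕ.+ suc n ℕ.* (n C suc k))
    ≡⟨ cong (a ℕ.+_) (ℕₚ.*-distribˡ-+ (suc n) (n C k) (n C suc k)) ⟨
  a ℕ.+ suc n ℕ.* (n C k ℕ.+ n C suc k)
    ≡⟨ cong (λ x → a ℕ.+ suc n ℕ.* x) (nCk+nC[k+1]≡[n+1]C[k+1] n k) ⟩
  suc (suc n) ℕ.* a ∎
  where
  a = suc n C suc k
  b = suc n C suc (suc k)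

binomialSum : ℕ → (ℕ → ℚ) → ℚ
binomialSum p f = sumTo p (λ n → f n * ℕ→ℚ (p C n))

pascalℚ : ∀ p n → ℕ→ℚ (suc p C suc n) ≡ ℕ→ℚ (p C n) + ℕ→ℚ (p C suc n)
pascalℚ p n = trans (cong ℕ→ℚ (sym (nCk+nC[k+1]≡[n+1]C[k+1] p n))) (ℕ→ℚ-+ (p C n) (p C suc n))

absorptionℚ : ∀ p n → ℕ→ℚ (suc n) * (ℕ→ℚ (p C n) + ℕ→ℚ (p C suc n)) ≡ ℕ→ℚ (suc p) * ℕ→ℚ (p C n)
absorptionℚ p n = begin
  ℕ→ℚ (suc n) * (ℕ→ℚ (p C n) + ℕ→ℚ (p C suc n)) ≡⟨ cong (ℕ→ℚ (suc n) *_) (pascalℚ p n) ⟨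
  ℕ→ℚ (suc n) * ℕ→ℚ (suc p C suc n)             ≡⟨ ℕ→ℚ-* (suc n) (suc p C suc n) ⟨
  ℕ→ℚ (suc n ℕ.* (suc p C suc n))               ≡⟨ cong ℕ→ℚ ([k+1]*[n+1]C[k+1]≡[n+1]*nCk p n) ⟩
  ℕ→ℚ (suc p ℕ.* (p C n))                       ≡⟨ ℕ→ℚ-* (suc p) (p C n) ⟩
  ℕ→ℚ (suc p) * ℕ→ℚ (p C n)                     ∎

binomialSum-head : ∀ p f → binomialSum p f ≡ f 0 + sumTo p (λ n → f (suc n) * ℕ→ℚ (p C suc n))
binomialSum-head p f = begin
  binomialSum p f
    ≡⟨ sumTo-extend p (suc p) (ℕₚ.n≤1+n p) beyondTop ⟩
  sumTo (suc p) (λ n → f n * ℕ→ℚ (p C n))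
    ≡⟨ sumTo-suc-head p _ ⟩
  f 0 * 1ℚ + sumTo p (λ n → f (suc n) * ℕ→ℚ (p C suc n))
    ≡⟨ cong (_+ sumTo p (λ n → f (suc n) * ℕ→ℚ (p C suc n))) (*-identityʳ (f 0)) ⟩
  f 0 + sumTo p (λ n → f (suc n) * ℕ→ℚ (p C suc n)) ∎
  where
  beyondTop : ∀ i → p < i → i ≤ suc p → f i * ℕ→ℚ (p C i) ≡ 0ℚ
  beyondTop i p<i _ = trans (cong (λ c → f i * ℕ→ℚ c) (k>n⇒nCk≡0 p<i)) (*-zeroʳ (f i))

binomialSum-suc : ∀ p f → binomialSum (suc p) f ≡ binomialSum p f + binomialSum p (f ∘ suc)
binomialSum-suc p f = begin
  binomialSum (suc p) f
    ≡⟨ sumTo-suc-head p _ ⟩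
  f 0 * 1ℚ + sumTo p (λ n → f (suc n) * ℕ→ℚ (suc p C suc n))
    ≡⟨ cong₂ _+_ (*-identityʳ (f 0))
                 (sumTo-cong p (λ n _ → trans (cong (f (suc n) *_) (pascalℚ p n)) (*-distribˡ-+ (f (suc n)) _ _))) ⟩
  f 0 + sumTo p (λ n → f (suc n) * ℕ→ℚ (p C n) + f (suc n) * ℕ→ℚ (p C suc n))
    ≡⟨ cong (f 0 +_) (trans (sumTo-+ p _ _) (+-comm (binomialSum p (f ∘ suc)) _)) ⟩
  f 0 + (sumTo p (λ n → f (suc n) * ℕ→ℚ (p C suc n)) + binomialSum p (f ∘ suc))
    ≡⟨ +-assoc (f 0) _ _ ⟨
  f 0 + sumTo p (λ n → f (suc n) * ℕ→ℚ (p C suc n)) + binomialSum p (f ∘ suc)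
    ≡⟨ cong (_+ binomialSum p (f ∘ suc)) (binomialSum-head p f) ⟨
  binomialSum p f + binomialSum p (f ∘ suc) ∎

binomialSum-absorb : ∀ p (g : ℕ → ℚ) →
  binomialSum p (λ n → ℕ→ℚ (suc n) * g (suc n) + ℕ→ℚ n * g n) ≡ ℕ→ℚ (suc p) * binomialSum p (g ∘ suc)
binomialSum-absorb p g = begin
  binomialSum p (λ n → h n + ℕ→ℚ n * g n)
    ≡⟨ trans (sumTo-cong p (λ n _ → *-distribʳ-+ (ℕ→ℚ (p C n)) (h n) _)) (sumTo-+ p _ _) ⟩
  binomialSum p h + binomialSum p (λ n → ℕ→ℚ n * g n)
    ≡⟨ cong (binomialSum p h +_) (binomialSum-head p (λ n → ℕ→ℚ n * g n)) ⟩
  binomialSum p h + (0ℚ * g 0 + sumTo p (λ n → h n * ℕ→ℚ (p C suc n)))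
    ≡⟨ cong (λ x → binomialSum p h + (x + sumTo p (λ n → h n * ℕ→ℚ (p C suc n)))) (*-zeroˡ (g 0)) ⟩
  binomialSum p h + (0ℚ + sumTo p (λ n → h n * ℕ→ℚ (p C suc n)))
    ≡⟨ cong (binomialSum p h +_) (+-identityˡ _) ⟩
  binomialSum p h + sumTo p (λ n → h n * ℕ→ℚ (p C suc n))
    ≡⟨ sumTo-+ p _ _ ⟨
  sumTo p (λ n → h n * ℕ→ℚ (p C n) + h n * ℕ→ℚ (p C suc n))
    ≡⟨ sumTo-cong p (λ n _ → absorbed n) ⟩
  sumTo p (λ n → ℕ→ℚ (suc p) * (g (suc n) * ℕ→ℚ (p C n)))
    ≡⟨ sumTo-*ˡ p (ℕ→ℚ (suc p)) _ ⟩
  ℕ→ℚ (suc p) * binomialSum p (g ∘ suc) ∎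
  where
  h : ℕ → ℚ
  h n = ℕ→ℚ (suc n) * g (suc n)
  absorbed : ∀ n → h n * ℕ→ℚ (p C n) + h n * ℕ→ℚ (p C suc n) ≡ ℕ→ℚ (suc p) * (g (suc n) * ℕ→ℚ (p C n))
  absorbed n = begin
    h n * ℕ→ℚ (p C n) + h n * ℕ→ℚ (p C suc n)
      ≡⟨ *-distribˡ-+ (h n) _ _ ⟨
    ℕ→ℚ (suc n) * g (suc n) * (ℕ→ℚ (p C n) + ℕ→ℚ (p C suc n))
      ≡⟨ xy∙z≈y∙xz (ℕ→ℚ (suc n)) (g (suc n)) _ ⟩
    g (suc n) * (ℕ→ℚ (suc n) * (ℕ→ℚ (p C n) + ℕ→ℚ (p C suc n)))
      ≡⟨ cong (g (suc n) *_) (absorptionℚ p n) ⟩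
    g (suc n) * (ℕ→ℚ (suc p) * ℕ→ℚ (p C n))
      ≡⟨ x∙yz≈y∙xz (g (suc n)) (ℕ→ℚ (suc p)) (ℕ→ℚ (p C n)) ⟩
    ℕ→ℚ (suc p) * (g (suc n) * ℕ→ℚ (p C n)) ∎

stirlingTerm : ℕ → ℕ → ℚ
stirlingTerm k n = s n k * invFact n

stirlingTerm-rec : ∀ k n →
  stirlingTerm k n ≡ ℕ→ℚ (suc n) * stirlingTerm (suc k) (suc n) + ℕ→ℚ n * stirlingTerm (suc k) n
stirlingTerm-rec k n = begin
  s n k * ι
    ≡⟨ cong (_* ι) s-pred ⟩
  (s′ + ℕ→ℚ n * t) * ι
    ≡⟨ *-distribʳ-+ ι s′ (ℕ→ℚ n * t) ⟩
  s′ * ι + ℕ→ℚ n * t * ι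
    ≡⟨ cong₂ _+_ (cong (s′ *_) (sym (suc*invFact-suc n))) (*-assoc (ℕ→ℚ n) t ι) ⟩
  s′ * (ℕ→ℚ (suc n) * invFact (suc n)) + ℕ→ℚ n * (t * ι)
    ≡⟨ cong (_+ ℕ→ℚ n * (t * ι)) (x∙yz≈y∙xz s′ (ℕ→ℚ (suc n)) (invFact (suc n))) ⟩
  ℕ→ℚ (suc n) * (s′ * invFact (suc n)) + ℕ→ℚ n * (t * ι) ∎
  where
  ι  = invFact n
  s′ = s (suc n) (suc k)
  t  = s n (suc k)
  s-pred : s n k ≡ s′ + ℕ→ℚ n * t
  s-pred = begin
    s n k                                  ≡⟨ solve 2 (λ a b → a := a :+ :- b :+ b) refl (s n k) (ℕ→ℚ n * t) ⟩
    s n k + - (ℕ→ℚ n * t) + ℕ→ℚ n * t      ≡⟨ cong (_+ ℕ→ℚ n * t) (s-suc-suc n k) ⟨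
    s′ + ℕ→ℚ n * t                         ∎

stirlingBinomial : ℕ → ℕ → ℚ
stirlingBinomial p k = binomialSum p (stirlingTerm k)

stirlingBinomial-suc-zero : ∀ p → stirlingBinomial (suc p) 0 ≡ stirlingBinomial p 0
stirlingBinomial-suc-zero p = begin
  stirlingBinomial (suc p) 0
    ≡⟨ binomialSum-suc p (stirlingTerm 0) ⟩
  stirlingBinomial p 0 + binomialSum p (stirlingTerm 0 ∘ suc)
    ≡⟨ cong (stirlingBinomial p 0 +_) (sumTo-zero p vanishing) ⟩
  stirlingBinomial p 0 + 0ℚ
    ≡⟨ +-identityʳ _ ⟩
  stirlingBinomial p 0 ∎
  where
  vanishing : ∀ n → n ≤ p → stirlingTerm 0 (suc n) * ℕ→ℚ (p C n) ≡ 0ℚ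
  vanishing n _ = begin
    s (suc n) 0 * invFact (suc n) * ℕ→ℚ (p C n)  ≡⟨ cong (λ x → x * invFact (suc n) * ℕ→ℚ (p C n)) (s-suc-zero n) ⟩
    0ℚ * invFact (suc n) * ℕ→ℚ (p C n)           ≡⟨ cong (_* ℕ→ℚ (p C n)) (*-zeroˡ (invFact (suc n))) ⟩
    0ℚ * ℕ→ℚ (p C n)                             ≡⟨ *-zeroˡ (ℕ→ℚ (p C n)) ⟩
    0ℚ                                           ∎

stirlingBinomial-suc-suc : ∀ p k →
  stirlingBinomial (suc p) (suc k) ≡ stirlingBinomial p (suc k) + invSuc p * stirlingBinomial p k
stirlingBinomial-suc-suc p k = begin
  stirlingBinomial (suc p) (suc k)
    ≡⟨ binomialSum-suc p (stirlingTerm (suc k)) ⟩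
  stirlingBinomial p (suc k) + binomialSum p (stirlingTerm (suc k) ∘ suc)
    ≡⟨ cong (stirlingBinomial p (suc k) +_) (suc*x≡y⇒x≡invSuc*y p scaled) ⟩
  stirlingBinomial p (suc k) + invSuc p * stirlingBinomial p k ∎
  where
  scaled : ℕ→ℚ (suc p) * binomialSum p (stirlingTerm (suc k) ∘ suc) ≡ stirlingBinomial p k
  scaled = begin
    ℕ→ℚ (suc p) * binomialSum p (stirlingTerm (suc k) ∘ suc)
      ≡⟨ binomialSum-absorb p (stirlingTerm (suc k)) ⟨
    binomialSum p (λ n → ℕ→ℚ (suc n) * stirlingTerm (suc k) (suc n) + ℕ→ℚ n * stirlingTerm (suc k) n)
      ≡⟨ sumTo-cong p (λ n _ → cong (_* ℕ→ℚ (p C n)) (stirlingTerm-rec k n)) ⟨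
    stirlingBinomial p k ∎

linear : ℚ → Series
linear c zero          = 1ℚ
linear c (suc zero)    = c
linear c (suc (suc _)) = 0ℚ

linear-⊛-suc : ∀ c f j → (linear c ⊛ f) (suc j) ≡ f (suc j) + c * f j
linear-⊛-suc c f j = begin
  (linear c ⊛ f) (suc j)
    ≡⟨ sumTo-suc-head j _ ⟩
  1ℚ * f (suc j) + sumTo j (λ i → linear c (suc i) * f (j ∸ i))
    ≡⟨ cong₂ _+_ (*-identityˡ (f (suc j))) (tail j) ⟩
  f (suc j) + c * f j ∎
  where
  tail : ∀ j → sumTo j (λ i → linear c (suc i) * f (j ∸ i)) ≡ c * f j
  tail zero    = refl
  tail (suc j) = begin
    sumTo (suc j) (λ i → linear c (suc i) * f (suc j ∸ i))
      ≡⟨ sumTo-suc-head j _ ⟩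
    c * f (suc j) + sumTo j (λ i → 0ℚ * f (j ∸ i))
      ≡⟨ cong (c * f (suc j) +_) (sumTo-zero j (λ i _ → *-zeroˡ (f (j ∸ i)))) ⟩
    c * f (suc j) + 0ℚ
      ≡⟨ +-identityʳ _ ⟩
    c * f (suc j) ∎

productSeries : ℕ → Series
productSeries zero    = one
productSeries (suc p) = linear (- invSuc p) ⊛ productSeries p

productSeries-zero : ∀ p → productSeries p 0 ≡ 1ℚ
productSeries-zero zero    = refl
productSeries-zero (suc p) = trans (*-identityˡ (productSeries p 0)) (productSeries-zero p)

stirlingBinomial≡±productSeries : ∀ p k → stirlingBinomial p k ≡ negOnePow k * productSeries p k
stirlingBinomial≡±productSeries zero    zero    = refl
stirlingBinomial≡±productSeries zero    (suc k) = sym (*-zeroʳ (negOnePow (suc k)))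
stirlingBinomial≡±productSeries (suc p) zero    = begin
  stirlingBinomial (suc p) 0       ≡⟨ stirlingBinomial-suc-zero p ⟩
  stirlingBinomial p 0             ≡⟨ stirlingBinomial≡±productSeries p 0 ⟩
  1ℚ * productSeries p 0           ≡⟨ cong (1ℚ *_) (*-identityˡ (productSeries p 0)) ⟨
  1ℚ * (1ℚ * productSeries p 0)    ∎
stirlingBinomial≡±productSeries (suc p) (suc k) = begin
  stirlingBinomial (suc p) (suc k)
    ≡⟨ stirlingBinomial-suc-suc p k ⟩
  stirlingBinomial p (suc k) + c * stirlingBinomial p k
    ≡⟨ cong₂ (λ x y → x + c * y) (stirlingBinomial≡±productSeries p (suc k)) (stirlingBinomial≡±productSeries p k) ⟩
  - σ * Π (suc k) + c * (σ * Π k)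
    ≡⟨ solve 4 (λ σ c x y → :- σ :* x :+ c :* (σ :* y) := :- σ :* (x :+ :- c :* y)) refl σ c (Π (suc k)) (Π k) ⟩
  - σ * (Π (suc k) + - c * Π k)
    ≡⟨ cong (- σ *_) (linear-⊛-suc (- c) Π k) ⟨
  negOnePow (suc k) * productSeries (suc p) (suc k) ∎
  where
  c = invSuc p
  σ = negOnePow k
  Π = productSeries p

scaledStirling : ℕ → ℕ → ℚ
scaledStirling p k = negOnePow p * invFact p * s (suc p) k

scaledStirling-zero : ∀ p → scaledStirling p 0 ≡ 0ℚ
scaledStirling-zero p = trans (cong (negOnePow p * invFact p *_) (s-suc-zero p)) (*-zeroʳ (negOnePow p * invFact p))

scaledStirling-suc : ∀ p k →
  scaledStirling (suc p) (suc k) ≡ scaledStirling p (suc k) + - invSuc p * scaledStirling p k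
scaledStirling-suc p k = begin
  - σ * invFact (suc p) * s (suc (suc p)) (suc k)
    ≡⟨ cong₂ (λ x y → - σ * x * y) (invFact-suc p) (s-suc-suc (suc p) k) ⟩
  - σ * (c * ι) * (a + - (N * b))
    ≡⟨ solve 6 (λ σ c ι a b N → :- σ :* (c :* ι) :* (a :+ :- (N :* b)) := σ :* ι :* b :* (c :* N) :+ :- c :* (σ :* ι :* a))
         refl σ c ι a b N ⟩
  σ * ι * b * (c * N) + - c * (σ * ι * a)
    ≡⟨ cong (λ x → σ * ι * b * x + - c * (σ * ι * a)) (invSuc-inverseˡ p) ⟩
  σ * ι * b * 1ℚ + - c * (σ * ι * a)
    ≡⟨ cong (_+ - c * (σ * ι * a)) (*-identityʳ (σ * ι * b)) ⟩
  scaledStirling p (suc k) + - c * scaledStirling p k ∎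
  where
  σ = negOnePow p
  c = invSuc p
  ι = invFact p
  N = ℕ→ℚ (suc p)
  a = s (suc p) k
  b = s (suc p) (suc k)

productSeries≡scaledStirling : ∀ p k → productSeries p k ≡ scaledStirling p (suc k)
productSeries≡scaledStirling zero    zero    = refl
productSeries≡scaledStirling zero    (suc k) = refl
productSeries≡scaledStirling (suc p) zero    = begin
  1ℚ * productSeries p 0
    ≡⟨ *-identityˡ _ ⟩
  productSeries p 0
    ≡⟨ productSeries≡scaledStirling p 0 ⟩
  scaledStirling p 1
    ≡⟨ +-identityʳ _ ⟨
  scaledStirling p 1 + 0ℚ
    ≡⟨ cong (scaledStirling p 1 +_) (trans (cong (- invSuc p *_) (scaledStirling-zero p)) (*-zeroʳ (- invSuc p))) ⟨
  scaledStirling p 1 + - invSuc p * scaledStirling p 0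
    ≡⟨ scaledStirling-suc p 0 ⟨
  scaledStirling (suc p) 1 ∎
productSeries≡scaledStirling (suc p) (suc k) = begin
  productSeries (suc p) (suc k)
    ≡⟨ linear-⊛-suc (- invSuc p) (productSeries p) k ⟩
  productSeries p (suc k) + - invSuc p * productSeries p k
    ≡⟨ cong₂ (λ x y → x + - invSuc p * y) (productSeries≡scaledStirling p (suc k)) (productSeries≡scaledStirling p k) ⟩
  scaledStirling p (suc (suc k)) + - invSuc p * scaledStirling p (suc k)
    ≡⟨ scaledStirling-suc p (suc k) ⟨
  scaledStirling (suc p) (suc (suc k)) ∎

sumFromLen-snoc : ∀ a L (f : ℕ → ℚ) → sumFromLen a (suc L) f ≡ sumFromLen a L f + f (a ℕ.+ L)
sumFromLen-snoc a zero    f rewrite ℕₚ.+-identityʳ a = trans (+-identityʳ (f a)) (sym (+-identityˡ (f a)))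
sumFromLen-snoc a (suc L) f = begin
  f a + sumFromLen (suc a) (suc L) f
    ≡⟨ cong (f a +_) (sumFromLen-snoc (suc a) L f) ⟩
  f a + (sumFromLen (suc a) L f + f (suc a ℕ.+ L))
    ≡⟨ +-assoc (f a) _ _ ⟨
  f a + sumFromLen (suc a) L f + f (suc a ℕ.+ L)
    ≡⟨ cong (λ i → f a + sumFromLen (suc a) L f + f i) (ℕₚ.+-suc a L) ⟨
  f a + sumFromLen (suc a) L f + f (a ℕ.+ suc L) ∎

sumFromLen-sumTo : ∀ n (f : ℕ → ℚ) → sumFromLen 0 (suc n) f ≡ sumTo n f
sumFromLen-sumTo zero    f = +-identityʳ (f 0)
sumFromLen-sumTo (suc n) f = trans (sumFromLen-snoc 0 (suc n) f) (cong (_+ f (suc n)) (sumFromLen-sumTo n f))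

sumFromTo-suc : ∀ m p (f : ℕ → ℚ) → f m ≡ 0ℚ → sumFromTo (suc m) p f ≡ sumFromTo m p f
sumFromTo-suc m p f fm≡0 with ℕₚ.≤-<-connex m p
... | inj₁ m≤p rewrite ℕₚ.+-∸-assoc 1 m≤p = sym (trans (cong (_+ sumFromLen (suc m) (p ∸ m) f) fm≡0) (+-identityˡ _))
... | inj₂ p<m rewrite ℕₚ.m≤n⇒m∸n≡0 p<m | ℕₚ.m≤n⇒m∸n≡0 (ℕₚ.<⇒≤ p<m) = refl

sumFromTo-sumTo : ∀ m p (f : ℕ → ℚ) → (∀ i → i < m → f i ≡ 0ℚ) → sumFromTo m p f ≡ sumTo p f
sumFromTo-sumTo zero    p f _   = sumFromLen-sumTo p f
sumFromTo-sumTo (suc m) p f f≡0 =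
  trans (sumFromTo-suc m p f (f≡0 m ℕₚ.≤-refl)) (sumFromTo-sumTo m p f (λ i i<m → f≡0 i (ℕₚ.m<n⇒m<1+n i<m)))

H-suc : ∀ p j → H (suc p) j ≡ H p j + powℚ (invSuc p) j
H-suc p j = sumFromLen-snoc 1 p (λ i → powℚ (invSuc (i ∸ 1)) j)

harmonicSeries : ℕ → Series
harmonicSeries p = bellSeries (λ j → - (ℕ→ℚ ((j ∸ 1) !) * H p j))

D-harmonicSeries : ∀ p n → D (harmonicSeries p) n ≡ - H p (suc n)
D-harmonicSeries p n = begin
  D (harmonicSeries p) n
    ≡⟨ D-bellSeries (λ j → - (ℕ→ℚ ((j ∸ 1) !) * H p j)) n ⟩
  - (ℕ→ℚ (n !) * H p (suc n)) * invFact n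
    ≡⟨ solve 3 (λ F h ι → :- (F :* h) :* ι := :- h :* (ι :* F)) refl (ℕ→ℚ (n !)) (H p (suc n)) (invFact n) ⟩
  - H p (suc n) * (invFact n * ℕ→ℚ (n !))
    ≡⟨ cong (- H p (suc n) *_) (invFact-inverseˡ n) ⟩
  - H p (suc n) * 1ℚ
    ≡⟨ *-identityʳ _ ⟩
  - H p (suc n) ∎

D-harmonicSeries-suc : ∀ p j → D (harmonicSeries (suc p)) j ≡ D (harmonicSeries p) j + - powℚ (invSuc p) (suc j)
D-harmonicSeries-suc p j = begin
  D (harmonicSeries (suc p)) j                         ≡⟨ D-harmonicSeries (suc p) j ⟩
  - H (suc p) (suc j)                                  ≡⟨ cong -_ (H-suc p (suc j)) ⟩
  - (H p (suc j) + powℚ (invSuc p) (suc j))            ≡⟨ neg-distrib-+ (H p (suc j)) _ ⟩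
  - H p (suc j) + - powℚ (invSuc p) (suc j)            ≡⟨ cong (_+ - powℚ (invSuc p) (suc j)) (D-harmonicSeries p j) ⟨
  D (harmonicSeries p) j + - powℚ (invSuc p) (suc j)   ∎

D-linear : ∀ x → D (linear (- x)) ≗ (λ j → - powℚ x (suc j)) ⊛ linear (- x)
D-linear x zero    = solve 1 (λ x → con 1ℚ :* :- x := :- (x :* con 1ℚ) :* con 1ℚ) refl x
D-linear x (suc j) = begin
  ℕ→ℚ (suc (suc j)) * 0ℚ
    ≡⟨ *-zeroʳ (ℕ→ℚ (suc (suc j))) ⟩
  0ℚ
    ≡⟨ solve 2 (λ x y → con 0ℚ := :- (x :* (x :* y)) :+ :- x :* :- (x :* y)) refl x (powℚ x j) ⟩
  δ (suc j) + - x * δ j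
    ≡⟨ linear-⊛-suc (- x) δ j ⟨
  (linear (- x) ⊛ δ) (suc j)
    ≡⟨ ⊛-comm (linear (- x)) δ (suc j) ⟩
  (δ ⊛ linear (- x)) (suc j) ∎
  where
  δ : Series
  δ j = - powℚ x (suc j)

D-productSeries : ∀ p n → D (productSeries p) n ≡ (D (harmonicSeries p) ⊛ productSeries p) n
D-productSeries zero    n = trans (D-one n) (sym (trans (⊛-comm (D (harmonicSeries 0)) one n)
  (⊛-zeroʳ one (D (harmonicSeries 0)) (λ i → D-harmonicSeries 0 i) n)))
D-productSeries (suc p) n = begin
  D (L ⊛ Π) n
    ≡⟨ D-⊛ L Π n ⟩
  (D L ⊛ Π) n + (L ⊛ D Π) n
    ≡⟨ cong₂ _+_ (⊛-cong (D-linear (invSuc p)) (λ i → refl {x = Π i}) n)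
                 (⊛-cong (λ i → refl {x = L i}) (D-productSeries p) n) ⟩
  ((δ ⊛ L) ⊛ Π) n + (L ⊛ (G′ ⊛ Π)) n
    ≡⟨ cong₂ _+_ (⊛-assoc δ L Π n) (f⊛[g⊛h]≗g⊛[f⊛h] L G′ Π n) ⟩
  (δ ⊛ (L ⊛ Π)) n + (G′ ⊛ (L ⊛ Π)) n
    ≡⟨ +-comm ((δ ⊛ (L ⊛ Π)) n) ((G′ ⊛ (L ⊛ Π)) n) ⟩
  (G′ ⊛ (L ⊛ Π)) n + (δ ⊛ (L ⊛ Π)) n
    ≡⟨ ⊛-distribʳ-+ G′ δ (L ⊛ Π) n ⟨
  ((λ j → G′ j + δ j) ⊛ (L ⊛ Π)) n
    ≡⟨ ⊛-cong (λ j → sym (D-harmonicSeries-suc p j)) (λ i → refl {x = (L ⊛ Π) i}) n ⟩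
  (D (harmonicSeries (suc p)) ⊛ (L ⊛ Π)) n ∎
  where
  L  = linear (- invSuc p)
  Π  = productSeries p
  G′ = D (harmonicSeries p)
  δ : Series
  δ j = - powℚ (invSuc p) (suc j)

productSeries≗expS : ∀ p → productSeries p ≗ expS (harmonicSeries p)
productSeries≗expS p = D-unique (D (harmonicSeries p)) (productSeries p) (expS (harmonicSeries p))
  (productSeries-zero p) (D-productSeries p) (D-expS refl)

cauchy-binomialSum : ∀ p →
  sumTo p (λ n → cauchy n * invFact n * ℕ→ℚ (p C n)) ≡ negOnePow p * invFact p * cauchyHat-1 p
cauchy-binomialSum p = begin
  sumTo p (λ n → cauchy n * invFact n * ℕ→ℚ (p C n))
    ≡⟨ sumTo-cong p cauchyTerm ⟩
  sumTo p (λ n → sumTo p (λ k → invSuc k * (stirlingTerm k n * ℕ→ℚ (p C n))))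
    ≡⟨ sumTo-swap p p _ ⟩
  sumTo p (λ k → sumTo p (λ n → invSuc k * (stirlingTerm k n * ℕ→ℚ (p C n))))
    ≡⟨ sumTo-cong p (λ k _ → sumTo-*ˡ p (invSuc k) _) ⟩
  sumTo p (λ k → invSuc k * stirlingBinomial p k)
    ≡⟨ sumTo-cong p (λ k _ → cong (invSuc k *_) (stirlingBinomial≡±productSeries p k)) ⟩
  sumTo p (λ k → invSuc k * (negOnePow k * productSeries p k))
    ≡⟨ sumTo-cong p (λ k _ → hatTerm k) ⟩
  sumTo p (λ k → negOnePow p * invFact p * (s (suc p) (suc k) * negOnePow k * invSuc k))
    ≡⟨ sumTo-*ˡ p (negOnePow p * invFact p) _ ⟩
  negOnePow p * invFact p * cauchyHat-1 p ∎
  where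
  cauchyTerm : ∀ n → n ≤ p →
    cauchy n * invFact n * ℕ→ℚ (p C n) ≡ sumTo p (λ k → invSuc k * (stirlingTerm k n * ℕ→ℚ (p C n)))
  cauchyTerm n n≤p = begin
    cauchy n * invFact n * ℕ→ℚ (p C n)                         ≡⟨ *-assoc (cauchy n) (invFact n) _ ⟩
    cauchy n * w                                                ≡⟨ sumTo-*ʳ n w _ ⟨
    sumTo n (λ k → s n k * invSuc k * w)                        ≡⟨ sumTo-extend n p n≤p aboveN ⟩
    sumTo p (λ k → s n k * invSuc k * w)                        ≡⟨ sumTo-cong p (λ k _ → rearrange (s n k) (invSuc k)) ⟩
    sumTo p (λ k → invSuc k * (stirlingTerm k n * ℕ→ℚ (p C n))) ∎
    where
    w = invFact n * ℕ→ℚ (p C n)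
    aboveN : ∀ k → n < k → k ≤ p → s n k * invSuc k * w ≡ 0ℚ
    aboveN k n<k _ rewrite s-above n<k = trans (cong (_* w) (*-zeroˡ (invSuc k))) (*-zeroˡ w)
    rearrange : ∀ a c → a * c * w ≡ c * (a * invFact n * ℕ→ℚ (p C n))
    rearrange a c = solve 4 (λ a c ι b → a :* c :* (ι :* b) := c :* (a :* ι :* b)) refl a c (invFact n) (ℕ→ℚ (p C n))
  hatTerm : ∀ k → invSuc k * (negOnePow k * productSeries p k)
                ≡ negOnePow p * invFact p * (s (suc p) (suc k) * negOnePow k * invSuc k)
  hatTerm k = begin
    invSuc k * (negOnePow k * productSeries p k)
      ≡⟨ cong (λ x → invSuc k * (negOnePow k * x)) (productSeries≡scaledStirling p k) ⟩
    invSuc k * (negOnePow k * (negOnePow p * invFact p * s (suc p) (suc k)))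
      ≡⟨ solve 5 (λ c τ σ ι t → c :* (τ :* (σ :* ι :* t)) := σ :* ι :* (t :* τ :* c)) refl
           (invSuc k) (negOnePow k) (negOnePow p) (invFact p) (s (suc p) (suc k)) ⟩
    negOnePow p * invFact p * (s (suc p) (suc k) * negOnePow k * invSuc k) ∎

stirling-binomialSum : ∀ m p →
  sumFromTo m p (λ n → s n m * invFact n * ℕ→ℚ (p C n))
    ≡ negOnePow m * invFact m * bellY m (λ j → - (ℕ→ℚ ((j ∸ 1) !) * H p j))
stirling-binomialSum m p = begin
  sumFromTo m p (λ n → stirlingTerm m n * ℕ→ℚ (p C n))
    ≡⟨ sumFromTo-sumTo m p _ belowM ⟩
  stirlingBinomial p m
    ≡⟨ stirlingBinomial≡±productSeries p m ⟩
  negOnePow m * productSeries p m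
    ≡⟨ cong (negOnePow m *_) (productSeries≗expS p m) ⟩
  negOnePow m * E
    ≡⟨ cong (negOnePow m *_) (trans (sym (*-identityˡ E)) (cong (_* E) (sym (invFact-inverseˡ m)))) ⟩
  negOnePow m * (invFact m * ℕ→ℚ (m !) * E)
    ≡⟨ trans (cong (negOnePow m *_) (*-assoc (invFact m) _ E)) (sym (*-assoc (negOnePow m) (invFact m) _)) ⟩
  negOnePow m * invFact m * (ℕ→ℚ (m !) * E)
    ≡⟨ cong (negOnePow m * invFact m *_) (bellY≡m!*expS m _) ⟨
  negOnePow m * invFact m * bellY m (λ j → - (ℕ→ℚ ((j ∸ 1) !) * H p j)) ∎
  where
  E = expS (harmonicSeries p) m
  belowM : ∀ n → n < m → stirlingTerm m n * ℕ→ℚ (p C n) ≡ 0ℚ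
  belowM n n<m rewrite s-above n<m = trans (cong (_* ℕ→ℚ (p C n)) (*-zeroˡ (invFact n))) (*-zeroˡ (ℕ→ℚ (p C n)))

mainTheorem4 : (m p : ℕ) →
    (sumTo p (λ n → cauchy n * invFact n * ℕ→ℚ (p C n))
      ≡ negOnePow p * invFact p * cauchyHat-1 p)
    ×
    (sumFromTo m p (λ n → s n m * invFact n * ℕ→ℚ (p C n))
      ≡ negOnePow m * invFact m
          * bellY m (λ j → - (ℕ→ℚ ((j ∸ 1) !) * H p j)))
mainTheorem4 m p = cauchy-binomialSum p , stirling-binomialSum m p
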